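{- Let $K$ be a field of characteristic $p>0$, let $G \subseteq H$ be finite subgroups of $(K,+)$, let $L/K$ be a field extension and let $a \in L$. If $f_G(a) \in K$, then $f_H(a) \in K$.
   Context: For a finite subgroup $G$ of $(K,+)$, $f_G(x) = \prod_{g \in G}(x-g) \in K[x]$. -}

module Defs where

open import Level using (Level; _⊔_)
open import Data.Nat using (ℕ; zero; suc)
open import Data.Nat.Primality using (Prime)
open import Data.Product using (Σ; ∃; _×_; _,_)
open import Data.List using (List; foldr; map)
open import Relation.Nullary using (¬_)
open import Algebra.Bundles using (CommutativeRing)
open import Algebra.Morphism.Structures using (module RingMorphisms)
import Data.List.Membership.Setoid as SetoidMembership
import Data.List.Relation.Unary.Unique.Setoid as SetoidUnique

private
  variable
    c ℓ c' ℓ' : Level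

record IsField (K : CommutativeRing c ℓ) : Set (c ⊔ ℓ) where
  open CommutativeRing K
  field
    1≉0     : ¬ (1# ≈ 0#)
    inverse : ∀ x → ¬ (x ≈ 0#) → Σ Carrier λ y → x * y ≈ 1#

module _ (R : CommutativeRing c ℓ) where
  open CommutativeRing R

  natToRing : ℕ → Carrier
  natToRing zero    = 0#
  natToRing (suc n) = 1# + natToRing n

  -- R has characteristic p > 0: p is prime and p · 1 = 0.  For a field
  -- (an integral domain) this determines the characteristic exactly.
  HasCharacteristic : ℕ → Set ℓ
  HasCharacteristic p = Prime p × (natToRing p ≈ 0#)

  open SetoidMembership setoid using (_∈_)
  open SetoidUnique setoid using (Unique)

  record FiniteAdditiveSubgroup : Set (c ⊔ ℓ) where
    field
      elems    : List Carrier
      unique   : Unique elems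
      0-closed : 0# ∈ elems
      +-closed : ∀ {x y} → x ∈ elems → y ∈ elems → (x + y) ∈ elems
      ≈-closed : ∀ {x y} → x ≈ y → x ∈ elems → y ∈ elems

  _⊆ₛ_ : FiniteAdditiveSubgroup → FiniteAdditiveSubgroup → Set (c ⊔ ℓ)
  G ⊆ₛ H = ∀ {x} → x ∈ FiniteAdditiveSubgroup.elems G → x ∈ FiniteAdditiveSubgroup.elems H

-- A field extension L/K: a ring homomorphism ι : K → L
-- (automatically injective since K is a field).
IsRingHom : (K : CommutativeRing c ℓ) (L : CommutativeRing c' ℓ') →
            (CommutativeRing.Carrier K → CommutativeRing.Carrier L) → Set _
IsRingHom K L ι =
  RingMorphisms.IsRingHomomorphism (CommutativeRing.rawRing K) (CommutativeRing.rawRing L) ι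

-- f_G evaluated at a ∈ L:  ∏_{g ∈ G} (a - ι g), computed in L.
evalSubgroupPoly : (K : CommutativeRing c ℓ) (L : CommutativeRing c' ℓ') →
                   (CommutativeRing.Carrier K → CommutativeRing.Carrier L) →
                   FiniteAdditiveSubgroup K → CommutativeRing.Carrier L →
                   CommutativeRing.Carrier L
evalSubgroupPoly K L ι G a =
  foldr _*_ 1# (map (λ g → a - ι g) (FiniteAdditiveSubgroup.elems G))
  where open CommutativeRing L

InImage : (K : CommutativeRing c ℓ) (L : CommutativeRing c' ℓ') →
          (CommutativeRing.Carrier K → CommutativeRing.Carrier L) →
          CommutativeRing.Carrier L → Set (c ⊔ ℓ')
InImage K L ι x = Σ (CommutativeRing.Carrier K) λ k → CommutativeRing._≈_ L (ι k) x

-- Let F = f_G, of degree n = |G|. A monic polynomial of degree n is determined by n of its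
-- values, and F(x + g) and F(x) both vanish on G, so F(x + g) = F(x) for g ∈ G; likewise
-- f_H(x + g) = f_H(x), as G ⊆ H. Expand f_H in base F, f_H = Σⱼ dⱼ Fʲ with dⱼ ∈ K[x] of degree
-- < n, and put Q = Σⱼ dⱼ F(a)ʲ ∈ K[x]. At the n distinct points a + g (g ∈ G) we get
-- Q(a + g) = f_H(a + g) = f_H(a), so Q is the constant f_H(a), and f_H(a) = Q(0) ∈ K.
module Submission where

open import Level using (Level; _⊔_)
open import Data.Nat using (ℕ; zero; suc)
open import Data.Product using (_,_; proj₁; proj₂; _×_)
open import Data.Empty using (⊥-elim)
open import Function using (_∘_)
open import Relation.Nullary using (¬_)
import Relation.Binary.PropositionalEquality as ≡
open ≡ using (_≢_)
open import Data.List using (List; []; _∷_; foldr; map; length)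
import Data.List.Relation.Unary.All as All
open All using (All; []; _∷_)
open import Data.List.Relation.Unary.Any as Any using (Any; here; there)
open import Data.List.Relation.Unary.Any.Properties using (¬Any[])
open import Data.List.Relation.Unary.AllPairs as AllPairs using (AllPairs; []; _∷_)
import Data.List.Membership.Setoid as SetoidMembership
open import Data.Vec using (Vec; []; _∷_; zipWith; replicate; _∷ʳ_; init; last)
import Data.Vec as Vec
open import Data.Vec.Relation.Unary.All as VecAll using ([]; _∷_) renaming (All to Allᵛ)
open import Data.Vec.Relation.Unary.All.Properties using (map⁺)
open import Algebra.Bundles using (CommutativeRing; Semiring)
open import Algebra.Morphism.Structures using (module RingMorphisms)
import Algebra.Properties.Group
open import Defs

module _ {a p} {A : Set a} {P : A → Set p} where
  ∷ʳ⁺ : ∀ {n} {xs : Vec A n} {y} → Allᵛ P xs → P y → Allᵛ P (xs ∷ʳ y)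
  ∷ʳ⁺ []         py = py ∷ []
  ∷ʳ⁺ (px ∷ pxs) py = px ∷ ∷ʳ⁺ pxs py

  init⁺ : ∀ {n} {xs : Vec A (suc n)} → Allᵛ P xs → Allᵛ P (init xs)
  init⁺ {xs = _ ∷ []}    _          = []
  init⁺ {xs = _ ∷ _ ∷ _} (px ∷ pxs) = px ∷ init⁺ pxs

  last⁺ : ∀ {n} {xs : Vec A (suc n)} → Allᵛ P xs → P (last xs)
  last⁺ {xs = _ ∷ []}    (px ∷ [])  = px
  last⁺ {xs = _ ∷ _ ∷ _} (_ ∷ pxs)  = last⁺ pxs

  replicate⁺ : ∀ n {x} → P x → Allᵛ P (replicate n x)
  replicate⁺ zero    px = []
  replicate⁺ (suc n) px = px ∷ replicate⁺ n px

record IsSubring {c ℓ s} (R : CommutativeRing c ℓ) (S : CommutativeRing.Carrier R → Set s) : Set (c ⊔ ℓ ⊔ s) where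
  open CommutativeRing R
  field
    ∈-resp-≈ : ∀ {x y} → x ≈ y → S x → S y
    0#-closed : S 0#
    1#-closed : S 1#
    +-closed : ∀ {x y} → S x → S y → S (x + y)
    *-closed : ∀ {x y} → S x → S y → S (x * y)
    -‿closed : ∀ {x} → S x → S (- x)

module Polynomial {c ℓ} (R : CommutativeRing c ℓ) where
  open CommutativeRing R
  open import Algebra.Definitions.RawSemiring (Semiring.rawSemiring semiring) using (_^_)
  open import Algebra.Properties.AbelianGroup +-abelianGroup using (⁻¹-anti-homo‿-)
  open import Algebra.Properties.Ring ring using (-1*x≈-x)
  open import Relation.Binary.Reasoning.Setoid setoid
  open import Algebra.Solver.Ring.NaturalCoefficients.Default commutativeSemiring

  -- Coefficients listed from the constant term up: Poly n holds the polynomials of degree < n.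
  Poly : ℕ → Set c
  Poly = Vec Carrier

  eval : ∀ {n} → Poly n → Carrier → Carrier
  eval []      x = 0#
  eval (a ∷ p) x = a + x * eval p x

  evalMonic : ∀ {n} → Poly n → Carrier → Carrier
  evalMonic {n} p x = x ^ n + eval p x

  infixl 6 _⊕_
  _⊕_ : ∀ {n} → Poly n → Poly n → Poly n
  _⊕_ = zipWith _+_

  scale : ∀ {n} → Carrier → Poly n → Poly n
  scale k = Vec.map (k *_)

  eval-⊕ : ∀ {n} (p q : Poly n) x → eval (p ⊕ q) x ≈ eval p x + eval q x
  eval-⊕ []      []      x = sym (+-identityʳ 0#)
  eval-⊕ (a ∷ p) (b ∷ q) x = begin
    (a + b) + x * eval (p ⊕ q) x        ≈⟨ +-cong refl (*-cong refl (eval-⊕ p q x)) ⟩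
    (a + b) + x * (eval p x + eval q x) ≈⟨ solve 5 (λ a b x P Q → (a :+ b) :+ x :* (P :+ Q) := (a :+ x :* P) :+ (b :+ x :* Q))
                                                 refl a b x (eval p x) (eval q x) ⟩
    (a + x * eval p x) + (b + x * eval q x) ∎

  eval-scale : ∀ {n} k (p : Poly n) x → eval (scale k p) x ≈ k * eval p x
  eval-scale k []      x = sym (zeroʳ k)
  eval-scale k (a ∷ p) x = begin
    k * a + x * eval (scale k p) x ≈⟨ +-cong refl (*-cong refl (eval-scale k p x)) ⟩
    k * a + x * (k * eval p x)     ≈⟨ solve 4 (λ k a x P → k :* a :+ x :* (k :* P) := k :* (a :+ x :* P)) refl k a x (eval p x) ⟩
    k * (a + x * eval p x)         ∎

  eval-∷ʳ : ∀ {n} (p : Poly n) b x → eval (p ∷ʳ b) x ≈ eval p x + b * x ^ n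
  eval-∷ʳ []      b x = solve 2 (λ b x → b :+ x :* con 0 := con 0 :+ b :* con 1) refl b x
  eval-∷ʳ {suc n} (a ∷ p) b x = begin
    a + x * eval (p ∷ʳ b) x          ≈⟨ +-cong refl (*-cong refl (eval-∷ʳ p b x)) ⟩
    a + x * (eval p x + b * x ^ n)   ≈⟨ solve 5 (λ a b x P X → a :+ x :* (P :+ b :* X) := a :+ x :* P :+ b :* (x :* X))
                                              refl a b x (eval p x) (x ^ n) ⟩
    a + x * eval p x + b * x ^ suc n ∎

  eval-init-last : ∀ {n} (p : Poly (suc n)) x → eval p x ≈ eval (init p) x + last p * x ^ n
  eval-init-last (a ∷ [])    x = solve 2 (λ a x → a :+ x :* con 0 := con 0 :+ a :* con 1) refl a x
  eval-init-last {suc n} (a ∷ b ∷ p) x = begin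
    a + x * eval (b ∷ p) x                            ≈⟨ +-cong refl (*-cong refl (eval-init-last (b ∷ p) x)) ⟩
    a + x * (eval (init (b ∷ p)) x + t * x ^ n)       ≈⟨ solve 5 (λ a t x I X → a :+ x :* (I :+ t :* X) := a :+ x :* I :+ t :* (x :* X))
                                                               refl a t x (eval (init (b ∷ p)) x) (x ^ n) ⟩
    a + x * eval (init (b ∷ p)) x + t * x ^ suc n     ∎
    where t = last (b ∷ p)

  eval-replicate-0# : ∀ n x → eval (replicate n 0#) x ≈ 0#
  eval-replicate-0# zero    x = refl
  eval-replicate-0# (suc n) x = begin
    0# + x * eval (replicate n 0#) x ≈⟨ +-cong refl (*-cong refl (eval-replicate-0# n x)) ⟩
    0# + x * 0#                      ≈⟨ solve 1 (λ x → con 0 :+ x :* con 0 := con 0) refl x ⟩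
    0#                               ∎

  infixl 6 _⊖_
  _⊖_ : ∀ {n} → Poly n → Poly n → Poly n
  p ⊖ q = p ⊕ scale (- 1#) q

  eval-⊖ : ∀ {n} (p q : Poly n) x → eval (p ⊖ q) x ≈ eval p x - eval q x
  eval-⊖ p q x = trans (eval-⊕ p (scale (- 1#) q) x) (+-cong refl (trans (eval-scale (- 1#) q x) (-1*x≈-x _)))

  evalMonic≈eval-∷ʳ1# : ∀ {n} (r : Poly n) x → evalMonic r x ≈ eval (r ∷ʳ 1#) x
  evalMonic≈eval-∷ʳ1# {n} r x = begin
    x ^ n + eval r x      ≈⟨ +-comm (x ^ n) (eval r x) ⟩
    eval r x + x ^ n      ≈⟨ +-cong refl (sym (*-identityˡ (x ^ n))) ⟩
    eval r x + 1# * x ^ n ≈⟨ sym (eval-∷ʳ r 1# x) ⟩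
    eval (r ∷ʳ 1#) x      ∎

  x+[y-y]*z≈x : ∀ x y z → x + (y - y) * z ≈ x
  x+[y-y]*z≈x x y z = trans (+-cong refl (trans (*-cong (-‿inverseʳ y) refl) (zeroˡ z))) (+-identityʳ x)

  divide : ∀ {n} → Poly (suc n) → Carrier → Poly n
  divide (a ∷ [])    c = []
  divide (a ∷ b ∷ p) c = eval (b ∷ p) c ∷ divide (b ∷ p) c

  remainder-theorem : ∀ {n} (p : Poly (suc n)) c x → eval p x ≈ (x - c) * eval (divide p c) x + eval p c
  remainder-theorem (a ∷ [])    c x = solve 4 (λ a x c -c → a :+ x :* con 0 := (x :+ -c) :* con 0 :+ (a :+ c :* con 0))
                                            refl a x c (- c)
  remainder-theorem (a ∷ b ∷ p) c x = begin
    a + x * eval (b ∷ p) x                                   ≈⟨ +-cong refl (*-cong refl (remainder-theorem (b ∷ p) c x)) ⟩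
    a + x * ((x - c) * eval q x + v)                         ≈⟨ sym (x+[y-y]*z≈x _ c v) ⟩
    a + x * ((x - c) * eval q x + v) + (c - c) * v           ≈⟨ solve 6 (λ a x c -c Q v → a :+ x :* ((x :+ -c) :* Q :+ v) :+ (c :+ -c) :* v := (x :+ -c) :* (v :+ x :* Q) :+ (a :+ c :* v))
                                                                      refl a x c (- c) (eval q x) v ⟩
    (x - c) * (v + x * eval q x) + (a + c * v)               ∎
    where
    q = divide (b ∷ p) c
    v = eval (b ∷ p) c

  -- Literally the shape of evalSubgroupPoly: f_G is rootProduct ι (elems G) by definition.
  rootProduct : ∀ {a} {A : Set a} → (A → Carrier) → List A → Carrier → Carrier
  rootProduct f ss x = foldr _*_ 1# (map (λ s → x - f s) ss)

  rootProductCoeffs : ∀ {a} {A : Set a} → (A → Carrier) → (ss : List A) → Poly (length ss)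
  rootProductCoeffs f []       = []
  rootProductCoeffs f (s ∷ ss) = (0# ∷ r) ⊕ scale (- f s) (r ∷ʳ 1#)
    where r = rootProductCoeffs f ss

  rootProduct-monic : ∀ {a} {A : Set a} (f : A → Carrier) ss x →
                      rootProduct f ss x ≈ evalMonic (rootProductCoeffs f ss) x
  rootProduct-monic f []       x = sym (+-identityʳ 1#)
  rootProduct-monic f (s ∷ ss) x = begin
    (x - f s) * rootProduct f ss x                                  ≈⟨ *-cong refl (rootProduct-monic f ss x) ⟩
    (x - f s) * (X + eval r x)                                      ≈⟨ solve 4 (λ x -t X P → (x :+ -t) :* (X :+ P) := x :* X :+ ((con 0 :+ x :* P) :+ -t :* (P :+ con 1 :* X)))
                                                                             refl x (- f s) X (eval r x) ⟩
    x * X + (eval (0# ∷ r) x + - f s * (eval r x + 1# * X))          ≈⟨ +-cong refl (+-cong refl (*-cong refl (sym (eval-∷ʳ r 1# x)))) ⟩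
    x * X + (eval (0# ∷ r) x + - f s * eval (r ∷ʳ 1#) x)             ≈⟨ +-cong refl (+-cong refl (sym (eval-scale (- f s) (r ∷ʳ 1#) x))) ⟩
    x * X + (eval (0# ∷ r) x + eval (scale (- f s) (r ∷ʳ 1#)) x)     ≈⟨ +-cong refl (sym (eval-⊕ (0# ∷ r) (scale (- f s) (r ∷ʳ 1#)) x)) ⟩
    evalMonic (rootProductCoeffs f (s ∷ ss)) x                      ∎
    where
    r = rootProductCoeffs f ss
    X = x ^ length ss

  rootProduct-root : ∀ {a} {A : Set a} (f : A → Carrier) ss {x} →
                     Any (λ s → x ≈ f s) ss → rootProduct f ss x ≈ 0#
  rootProduct-root f (s ∷ ss) (here x≈fs) = trans (*-cong (trans (+-cong x≈fs refl) (-‿inverseʳ (f s))) refl) (zeroˡ _)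
  rootProduct-root f (s ∷ ss) (there ∈ss) = trans (*-cong refl (rootProduct-root f ss ∈ss)) (zeroʳ _)

  rootProduct-roots : ∀ {a} {A : Set a} (f : A → Carrier) ss → All (λ t → rootProduct f ss (f t) ≈ 0#) ss
  rootProduct-roots f []       = []
  rootProduct-roots f (s ∷ ss) =
    trans (*-cong (-‿inverseʳ (f s)) refl) (zeroˡ _)
      ∷ All.map (λ z → trans (*-cong refl z) (zeroʳ _)) (rootProduct-roots f ss)

  rootProduct-shift : ∀ {a} {A : Set a} (f : A → Carrier) ss c x →
                      rootProduct f ss (x + c) ≈ rootProduct (λ s → f s - c) ss x
  rootProduct-shift f []       c x = refl
  rootProduct-shift f (s ∷ ss) c x = *-cong factor (rootProduct-shift f ss c x)
    where
    factor : x + c - f s ≈ x - (f s - c)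
    factor = trans (+-assoc x c (- f s)) (+-cong refl (sym (⁻¹-anti-homo‿- (f s) c)))

  -- Base-F expansion p = Σⱼ dⱼ Fʲ with digits dⱼ of degree < deg F, built by Horner's scheme
  -- from x · d = reduceX d + last d · F.
  module Expansion {n} (r : Poly (suc n)) where
    F : Carrier → Carrier
    F = evalMonic r

    Digit : Set c
    Digit = Poly (suc n)

    evalExpansion : List Digit → Carrier → Carrier → Carrier
    evalExpansion []       y x = 0#
    evalExpansion (d ∷ ds) y x = eval d x + y * evalExpansion ds y x

    evalExpansion-cong : ∀ ds {y y′} x → y ≈ y′ → evalExpansion ds y x ≈ evalExpansion ds y′ x
    evalExpansion-cong []       x y≈y′ = refl
    evalExpansion-cong (d ∷ ds) x y≈y′ = +-cong refl (*-cong y≈y′ (evalExpansion-cong ds x y≈y′))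

    addConstant : Carrier → List Digit → List Digit
    addConstant t []             = (t ∷ replicate n 0#) ∷ []
    addConstant t ((a ∷ d) ∷ ds) = ((t + a) ∷ d) ∷ ds

    evalExpansion-addConstant : ∀ t ds y x → evalExpansion (addConstant t ds) y x ≈ t + evalExpansion ds y x
    evalExpansion-addConstant t [] y x = begin
      t + x * eval (replicate n 0#) x + y * 0# ≈⟨ +-cong (+-cong refl (*-cong refl (eval-replicate-0# n x))) refl ⟩
      t + x * 0# + y * 0#                     ≈⟨ solve 3 (λ t x y → t :+ x :* con 0 :+ y :* con 0 := t :+ con 0) refl t x y ⟩
      t + 0#                                  ∎
    evalExpansion-addConstant t ((a ∷ d) ∷ ds) y x =
      solve 5 (λ t a x D E → t :+ a :+ x :* D :+ E := t :+ (a :+ x :* D :+ E)) refl t a x (eval d x) (y * evalExpansion ds y x)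

    reduceX : Digit → Digit
    reduceX d = (0# ∷ init d) ⊕ scale (- last d) r

    x*eval≈eval-reduceX : ∀ d x → x * eval d x ≈ eval (reduceX d) x + last d * F x
    x*eval≈eval-reduceX d x = begin
      x * eval d x                                      ≈⟨ *-cong refl (eval-init-last d x) ⟩
      x * (I + t * x ^ n)                               ≈⟨ sym (x+[y-y]*z≈x _ t (eval r x)) ⟩
      x * (I + t * x ^ n) + (t - t) * eval r x          ≈⟨ solve 6 (λ x I t -t X R → x :* (I :+ t :* X) :+ (t :+ -t) :* R := con 0 :+ x :* I :+ -t :* R :+ t :* (x :* X :+ R))
                                                                 refl x I t (- t) (x ^ n) (eval r x) ⟩
      eval (0# ∷ init d) x + - t * eval r x + t * F x   ≈⟨ +-cong (+-cong refl (sym (eval-scale (- t) r x))) refl ⟩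
      eval (0# ∷ init d) x + eval (scale (- t) r) x + t * F x ≈⟨ +-cong (sym (eval-⊕ (0# ∷ init d) (scale (- t) r) x)) refl ⟩
      eval (reduceX d) x + t * F x                      ∎
      where
      I = eval (init d) x
      t = last d

    mulX : List Digit → List Digit
    mulX []       = []
    mulX (d ∷ ds) = reduceX d ∷ addConstant (last d) (mulX ds)

    evalExpansion-mulX : ∀ ds x → x * evalExpansion ds (F x) x ≈ evalExpansion (mulX ds) (F x) x
    evalExpansion-mulX []       x = zeroʳ x
    evalExpansion-mulX (d ∷ ds) x = begin
      x * (eval d x + F x * E)                      ≈⟨ solve 4 (λ x D f E → x :* (D :+ f :* E) := x :* D :+ f :* (x :* E))
                                                             refl x (eval d x) (F x) E ⟩
      x * eval d x + F x * (x * E)                  ≈⟨ +-cong (x*eval≈eval-reduceX d x) (*-cong refl (evalExpansion-mulX ds x)) ⟩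
      eval (reduceX d) x + t * F x + F x * M        ≈⟨ solve 4 (λ D t f M → D :+ t :* f :+ f :* M := D :+ f :* (t :+ M))
                                                             refl (eval (reduceX d) x) t (F x) M ⟩
      eval (reduceX d) x + F x * (t + M)            ≈⟨ +-cong refl (*-cong refl (sym (evalExpansion-addConstant t (mulX ds) (F x) x))) ⟩
      evalExpansion (mulX (d ∷ ds)) (F x) x         ∎
      where
      E = evalExpansion ds (F x) x
      t = last d
      M = evalExpansion (mulX ds) (F x) x

    expansion : ∀ {k} → Poly k → List Digit
    expansion []      = []
    expansion (a ∷ p) = addConstant a (mulX (expansion p))

    eval-expansion : ∀ {k} (p : Poly k) x → eval p x ≈ evalExpansion (expansion p) (F x) x
    eval-expansion []      x = refl
    eval-expansion (a ∷ p) x = begin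
      a + x * eval p x                                   ≈⟨ +-cong refl (*-cong refl (eval-expansion p x)) ⟩
      a + x * evalExpansion (expansion p) (F x) x        ≈⟨ +-cong refl (evalExpansion-mulX (expansion p) x) ⟩
      a + evalExpansion (mulX (expansion p)) (F x) x     ≈⟨ sym (evalExpansion-addConstant a (mulX (expansion p)) (F x) x) ⟩
      evalExpansion (expansion (a ∷ p)) (F x) x          ∎

    specialise : Carrier → List Digit → Digit
    specialise y []       = replicate (suc n) 0#
    specialise y (d ∷ ds) = d ⊕ scale y (specialise y ds)

    eval-specialise : ∀ y ds x → eval (specialise y ds) x ≈ evalExpansion ds y x
    eval-specialise y []       x = eval-replicate-0# (suc n) x
    eval-specialise y (d ∷ ds) x = begin
      eval (d ⊕ scale y (specialise y ds)) x             ≈⟨ eval-⊕ d (scale y (specialise y ds)) x ⟩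
      eval d x + eval (scale y (specialise y ds)) x      ≈⟨ +-cong refl (eval-scale y (specialise y ds) x) ⟩
      eval d x + y * eval (specialise y ds) x            ≈⟨ +-cong refl (*-cong refl (eval-specialise y ds x)) ⟩
      evalExpansion (d ∷ ds) y x                         ∎

  module Coefficients {s} {S : Carrier → Set s} (S-subring : IsSubring R S) where
    open IsSubring S-subring

    ⊕-closed : ∀ {n} {p q : Poly n} → Allᵛ S p → Allᵛ S q → Allᵛ S (p ⊕ q)
    ⊕-closed = VecAll.zipWith +-closed

    scale-closed : ∀ {n} {k} {p : Poly n} → S k → Allᵛ S p → Allᵛ S (scale k p)
    scale-closed k∈S p∈S = map⁺ (VecAll.map (*-closed k∈S) p∈S)

    eval-closed : ∀ {n} {p : Poly n} {x} → Allᵛ S p → S x → S (eval p x)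
    eval-closed []           x∈S = 0#-closed
    eval-closed (a∈S ∷ p∈S) x∈S = +-closed a∈S (*-closed x∈S (eval-closed p∈S x∈S))

    rootProductCoeffs-closed : ∀ {a} {A : Set a} (f : A → Carrier) {ss} →
                               All (λ s → S (f s)) ss → Allᵛ S (rootProductCoeffs f ss)
    rootProductCoeffs-closed f []           = []
    rootProductCoeffs-closed f (fs∈S ∷ fss∈S) =
      ⊕-closed (0#-closed ∷ r∈S) (scale-closed (-‿closed fs∈S) (∷ʳ⁺ r∈S 1#-closed))
      where r∈S = rootProductCoeffs-closed f fss∈S

    module _ {n} {r : Poly (suc n)} (r∈S : Allᵛ S r) where
      open Expansion r

      addConstant-closed : ∀ {t} ds → S t → All (Allᵛ S) ds → All (Allᵛ S) (addConstant t ds)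
      addConstant-closed []             t∈S []                    = (t∈S ∷ replicate⁺ n 0#-closed) ∷ []
      addConstant-closed ((a ∷ d) ∷ ds) t∈S ((a∈S ∷ d∈S) ∷ ds∈S) = (+-closed t∈S a∈S ∷ d∈S) ∷ ds∈S

      reduceX-closed : ∀ {d} → Allᵛ S d → Allᵛ S (reduceX d)
      reduceX-closed d∈S = ⊕-closed (0#-closed ∷ init⁺ d∈S) (scale-closed (-‿closed (last⁺ d∈S)) r∈S)

      mulX-closed : ∀ {ds} → All (Allᵛ S) ds → All (Allᵛ S) (mulX ds)
      mulX-closed []           = []
      mulX-closed {d ∷ ds} (d∈S ∷ ds∈S) =
        reduceX-closed d∈S ∷ addConstant-closed (mulX ds) (last⁺ d∈S) (mulX-closed ds∈S)

      expansion-closed : ∀ {k} {p : Poly k} → Allᵛ S p → All (Allᵛ S) (expansion p)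
      expansion-closed []                   = []
      expansion-closed {p = a ∷ p} (a∈S ∷ p∈S) =
        addConstant-closed (mulX (expansion p)) a∈S (mulX-closed (expansion-closed p∈S))

      specialise-closed : ∀ {y ds} → S y → All (Allᵛ S) ds → Allᵛ S (specialise y ds)
      specialise-closed y∈S []           = replicate⁺ (suc n) 0#-closed
      specialise-closed y∈S (d∈S ∷ ds∈S) = ⊕-closed d∈S (scale-closed y∈S (specialise-closed y∈S ds∈S))

module PolynomialOverField {c ℓ} (R : CommutativeRing c ℓ) (R-field : IsField R) where
  open CommutativeRing R
  open Polynomial R
  open import Algebra.Properties.Group +-group using (x∙y⁻¹≈ε⇒x≈y; x≈y⇒x∙y⁻¹≈ε; ∙-cancelˡ)
  open import Algebra.Solver.Ring.NaturalCoefficients.Default commutativeSemiring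
  open import Relation.Binary.Reasoning.Setoid setoid

  Distinct : ∀ {a} {A : Set a} → (A → Carrier) → List A → Set (a ⊔ ℓ)
  Distinct f = AllPairs (λ s t → ¬ f s ≈ f t)

  x≉0∧x*y≈0⇒y≈0 : ∀ {x y} → ¬ x ≈ 0# → x * y ≈ 0# → y ≈ 0#
  x≉0∧x*y≈0⇒y≈0 {x} {y} x≉0 xy≈0 = begin
    y               ≈⟨ sym (*-identityˡ y) ⟩
    1# * y          ≈⟨ *-cong (sym x⁻¹x≈1) refl ⟩
    (x⁻¹ * x) * y   ≈⟨ *-assoc x⁻¹ x y ⟩
    x⁻¹ * (x * y)   ≈⟨ *-cong refl xy≈0 ⟩
    x⁻¹ * 0#        ≈⟨ zeroʳ x⁻¹ ⟩
    0#              ∎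
    where
    open IsField R-field using (inverse)
    x⁻¹ = proj₁ (inverse x x≉0)
    x⁻¹x≈1 = trans (*-comm x⁻¹ x) (proj₂ (inverse x x≉0))

  eval-vanishing : ∀ {a} {A : Set a} (f : A → Carrier) ss → Distinct f ss → (p : Poly (length ss)) →
                   All (λ s → eval p (f s) ≈ 0#) ss → ∀ x → eval p x ≈ 0#
  eval-vanishing f []       []                 []  []                   x = refl
  eval-vanishing f (s ∷ ss) (fs≉fss ∷ distinct) p (ps≈0 ∷ pss≈0) x = begin
    eval p x                            ≈⟨ remainder-theorem p (f s) x ⟩
    (x - f s) * eval q x + eval p (f s) ≈⟨ +-cong (*-cong refl (eval-vanishing f ss distinct q qss≈0 x)) ps≈0 ⟩
    (x - f s) * 0# + 0#                 ≈⟨ trans (+-identityʳ _) (zeroʳ _) ⟩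
    0#                                  ∎
    where
    q = divide p (f s)
    quotient-root : ∀ {t} → ¬ f s ≈ f t × eval p (f t) ≈ 0# → eval q (f t) ≈ 0#
    quotient-root {t} (fs≉ft , pt≈0) =
      x≉0∧x*y≈0⇒y≈0 (λ ft-fs≈0 → fs≉ft (sym (x∙y⁻¹≈ε⇒x≈y _ _ ft-fs≈0))) (begin
      (f t - f s) * eval q (f t)                 ≈⟨ sym (+-identityʳ _) ⟩
      (f t - f s) * eval q (f t) + 0#            ≈⟨ +-cong refl (sym ps≈0) ⟩
      (f t - f s) * eval q (f t) + eval p (f s)  ≈⟨ sym (remainder-theorem p (f s) (f t)) ⟩
      eval p (f t)                               ≈⟨ pt≈0 ⟩
      0#                                         ∎)
    qss≈0 = All.zipWith quotient-root (fs≉fss , pss≈0)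

  eval-constant : ∀ {a} {A : Set a} (f : A → Carrier) s ss → Distinct f (s ∷ ss) →
                  (p : Poly (length (s ∷ ss))) {d : Carrier} → All (λ t → eval p (f t) ≈ d) (s ∷ ss) →
                  ∀ x → eval p x ≈ d
  eval-constant f s ss distinct (a ∷ p) {d} p≈d x =
    x∙y⁻¹≈ε⇒x≈y _ _ (trans (lower x) (eval-vanishing f (s ∷ ss) distinct ((a - d) ∷ p) lowered≈0 x))
    where
    lower : ∀ y → eval (a ∷ p) y - d ≈ eval ((a - d) ∷ p) y
    lower y = solve 4 (λ a -d y P → a :+ y :* P :+ -d := a :+ -d :+ y :* P) refl a (- d) y (eval p y)
    lowered≈0 = All.map (λ pt≈d → trans (sym (lower _)) (x≈y⇒x∙y⁻¹≈ε pt≈d)) p≈d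

  evalMonic-unique : ∀ {a} {A : Set a} (f : A → Carrier) ss → Distinct f ss → (r r′ : Poly (length ss)) →
                     All (λ s → evalMonic r (f s) ≈ evalMonic r′ (f s)) ss → ∀ x → evalMonic r x ≈ evalMonic r′ x
  evalMonic-unique f ss distinct r r′ agree x =
    +-cong refl (x∙y⁻¹≈ε⇒x≈y _ _
      (trans (sym (eval-⊖ r r′ x)) (eval-vanishing f ss distinct (r ⊖ r′) difference≈0 x)))
    where
    difference≈0 = All.map (λ {s} rs≈r′s →
      trans (eval-⊖ r r′ (f s)) (x≈y⇒x∙y⁻¹≈ε (∙-cancelˡ _ _ _ rs≈r′s))) agree

  -- Both sides are monic of degree |ss| and vanish at every f t, since f t + c is again a root.
  rootProduct-translationInvariant : ∀ {a} {A : Set a} (f : A → Carrier) ss → Distinct f ss → ∀ c →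
                                     All (λ s → Any (λ t → f s + c ≈ f t) ss) ss →
                                     ∀ x → rootProduct f ss (x + c) ≈ rootProduct f ss x
  rootProduct-translationInvariant f ss distinct c closed x = begin
    rootProduct f ss (x + c)               ≈⟨ rootProduct-shift f ss c x ⟩
    rootProduct f-c ss x                   ≈⟨ rootProduct-monic f-c ss x ⟩
    evalMonic (rootProductCoeffs f-c ss) x ≈⟨ evalMonic-unique f ss distinct (rootProductCoeffs f-c ss) (rootProductCoeffs f ss) agree x ⟩
    evalMonic (rootProductCoeffs f ss) x   ≈⟨ sym (rootProduct-monic f ss x) ⟩
    rootProduct f ss x                     ∎
    where
    f-c = λ s → f s - c
    agree = All.zipWith (λ {t} (shifted-root , root) → begin
      evalMonic (rootProductCoeffs f-c ss) (f t) ≈⟨ sym (rootProduct-monic f-c ss (f t)) ⟩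
      rootProduct f-c ss (f t)                   ≈⟨ sym (rootProduct-shift f ss c (f t)) ⟩
      rootProduct f ss (f t + c)                 ≈⟨ rootProduct-root f ss shifted-root ⟩
      0#                                         ≈⟨ sym root ⟩
      rootProduct f ss (f t)                     ≈⟨ rootProduct-monic f ss (f t) ⟩
      evalMonic (rootProductCoeffs f ss) (f t)   ∎) (closed , rootProduct-roots f ss)

  module _ {s} {S : Carrier → Set s} (S-subring : IsSubring R S) where
    open IsSubring S-subring using (∈-resp-≈; 0#-closed)
    open Coefficients S-subring

    descent : ∀ {a} {A : Set a} (f : A → Carrier) ss → ss ≢ [] → Distinct f ss →
              (r : Poly (length ss)) → Allᵛ S r → ∀ {k} (p : Poly k) → Allᵛ S p → ∀ {y z} → S y →
              All (λ t → evalMonic r (f t) ≈ y) ss → All (λ t → eval p (f t) ≈ z) ss → S z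
    descent f []       ss≢[] = ⊥-elim (ss≢[] ≡.refl)
    descent f (t ∷ ts) _ distinct r r∈S p p∈S {y} {z} y∈S F≈y p≈z =
      ∈-resp-≈ (q-constant 0#) (eval-closed (specialise-closed r∈S y∈S (expansion-closed r∈S p∈S)) 0#-closed)
      where
      open Expansion r
      q = specialise y (expansion p)
      q≈p : ∀ {u} → F (f u) ≈ y → eval q (f u) ≈ eval p (f u)
      q≈p {u} Fu≈y = begin
        eval q (f u)                                    ≈⟨ eval-specialise y (expansion p) (f u) ⟩
        evalExpansion (expansion p) y (f u)             ≈⟨ evalExpansion-cong (expansion p) (f u) (sym Fu≈y) ⟩
        evalExpansion (expansion p) (F (f u)) (f u)     ≈⟨ sym (eval-expansion p (f u)) ⟩
        eval p (f u)                                    ∎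
      q-constant = eval-constant f t ts distinct q
        (All.zipWith (λ (Fu≈y , pu≈z) → trans (q≈p Fu≈y) pu≈z) (F≈y , p≈z))

module SubgroupPolynomial {c ℓ c′ ℓ′} {K : CommutativeRing c ℓ} {L : CommutativeRing c′ ℓ′}
    (K-field : IsField K) (L-field : IsField L)
    {ι : CommutativeRing.Carrier K → CommutativeRing.Carrier L} (ι-hom : IsRingHom K L ι) where
  private
    module K = CommutativeRing K
    module K-group = Algebra.Properties.Group K.+-group
  open CommutativeRing L
  open RingMorphisms.IsRingHomomorphism ι-hom
  open Polynomial L
  open PolynomialOverField L L-field
  open SetoidMembership K.setoid using (_∈_)
  open import Algebra.Properties.Group +-group using (∙-cancelˡ)
  open import Relation.Binary.Reasoning.Setoid setoid

  -- Injectivity in the form available constructively: K provides inverses only for elements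
  -- known to be ≉ 0.
  ι-preserves-≉ : ∀ {x y} → ¬ x K.≈ y → ¬ ι x ≈ ι y
  ι-preserves-≉ {x} {y} x≉y ιx≈ιy = IsField.1≉0 L-field (begin
    1#              ≈⟨ sym 1#-homo ⟩
    ι K.1#          ≈⟨ ⟦⟧-cong (K.sym dd⁻¹≈1) ⟩
    ι (d K.* d⁻¹)   ≈⟨ *-homo d d⁻¹ ⟩
    ι d * ι d⁻¹     ≈⟨ *-cong ιd≈0 refl ⟩
    0# * ι d⁻¹      ≈⟨ zeroˡ (ι d⁻¹) ⟩
    0#              ∎)
    where
    d = x K.- y
    d⁻¹ = proj₁ (IsField.inverse K-field d (x≉y ∘ K-group.x∙y⁻¹≈ε⇒x≈y x y))
    dd⁻¹≈1 = proj₂ (IsField.inverse K-field d (x≉y ∘ K-group.x∙y⁻¹≈ε⇒x≈y x y))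
    ιd≈0 = trans (+-homo x (K.- y)) (trans (+-cong ιx≈ιy (-‿homo y)) (-‿inverseʳ (ι y)))

  image-isSubring : IsSubring L (InImage K L ι)
  image-isSubring = record
    { ∈-resp-≈  = λ { x≈y (k , ιk≈x) → k , trans ιk≈x x≈y }
    ; 0#-closed = K.0# , 0#-homo
    ; 1#-closed = K.1# , 1#-homo
    ; +-closed  = λ { (k , ιk≈x) (l , ιl≈y) → k K.+ l , trans (+-homo k l) (+-cong ιk≈x ιl≈y) }
    ; *-closed  = λ { (k , ιk≈x) (l , ιl≈y) → k K.* l , trans (*-homo k l) (*-cong ιk≈x ιl≈y) }
    ; -‿closed  = λ { (k , ιk≈x) → K.- k , trans (-‿homo k) (-‿cong ιk≈x) }
    }

  module _ (G : FiniteAdditiveSubgroup K) where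
    open FiniteAdditiveSubgroup G

    elems≢[] : elems ≢ []
    elems≢[] elems≡[] = ¬Any[] (≡.subst (Any _) elems≡[] 0-closed)

    elems-distinct : Distinct ι elems
    elems-distinct = AllPairs.map ι-preserves-≉ unique

    translates-distinct : ∀ a → Distinct (λ t → a + ι t) elems
    translates-distinct a = AllPairs.map (λ s≉t → ι-preserves-≉ s≉t ∘ ∙-cancelˡ a _ _) unique

    subgroupPolyCoeffs-closed : Allᵛ (InImage K L ι) (rootProductCoeffs ι elems)
    subgroupPolyCoeffs-closed =
      Coefficients.rootProductCoeffs-closed image-isSubring ι (All.universal (λ s → s , refl) elems)

    subgroupPoly-translationInvariant : ∀ {g} → g ∈ elems → ∀ x →
                                        evalSubgroupPoly K L ι G (x + ι g) ≈ evalSubgroupPoly K L ι G x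
    subgroupPoly-translationInvariant g∈G =
      rootProduct-translationInvariant ι elems elems-distinct _
        (All.tabulateₛ K.setoid (λ s∈G →
          Any.map (λ s+g≈t → trans (sym (+-homo _ _)) (⟦⟧-cong s+g≈t)) (+-closed s∈G g∈G)))

corollary4p4 : ∀ {c ℓ c' ℓ' : Level}
    (K : CommutativeRing c ℓ) → IsField K →
    (p : ℕ) → HasCharacteristic K p →
    (G H : FiniteAdditiveSubgroup K) → _⊆ₛ_ K G H →
    (L : CommutativeRing c' ℓ') → IsField L →
    (ι : CommutativeRing.Carrier K → CommutativeRing.Carrier L) → IsRingHom K L ι →
    (a : CommutativeRing.Carrier L) →
    InImage K L ι (evalSubgroupPoly K L ι G a) →
    InImage K L ι (evalSubgroupPoly K L ι H a)
corollary4p4 K K-field _ _ G H G⊆H L L-field ι ι-hom a fG[a]∈K =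
  descent image-isSubring translate G.elems (elems≢[] G) (translates-distinct G a)
    (rootProductCoeffs ι G.elems) (subgroupPolyCoeffs-closed G)
    (rootProductCoeffs ι H.elems ∷ʳ 1#) (∷ʳ⁺ (subgroupPolyCoeffs-closed H) (IsSubring.1#-closed image-isSubring))
    fG[a]∈K (All.tabulateₛ K.setoid fG-constant) (All.tabulateₛ K.setoid fH-constant)
  where
  module K = CommutativeRing K
  module G = FiniteAdditiveSubgroup G
  module H = FiniteAdditiveSubgroup H
  open CommutativeRing L
  open Polynomial L
  open PolynomialOverField L L-field using (descent)
  open SubgroupPolynomial K-field L-field ι-hom
  open SetoidMembership K.setoid using (_∈_)
  open import Relation.Binary.Reasoning.Setoid setoid

  translate : K.Carrier → Carrier
  translate t = a + ι t

  fG-constant : ∀ {t} → t ∈ G.elems →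
                evalMonic (rootProductCoeffs ι G.elems) (translate t) ≈ evalSubgroupPoly K L ι G a
  fG-constant t∈G = trans (sym (rootProduct-monic ι G.elems _)) (subgroupPoly-translationInvariant G t∈G a)

  fH-constant : ∀ {t} → t ∈ G.elems →
                eval (rootProductCoeffs ι H.elems ∷ʳ 1#) (translate t) ≈ evalSubgroupPoly K L ι H a
  fH-constant {t} t∈G = begin
    eval (rootProductCoeffs ι H.elems ∷ʳ 1#) (translate t) ≈⟨ sym (evalMonic≈eval-∷ʳ1# (rootProductCoeffs ι H.elems) (translate t)) ⟩
    evalMonic (rootProductCoeffs ι H.elems) (translate t)  ≈⟨ sym (rootProduct-monic ι H.elems (translate t)) ⟩
    evalSubgroupPoly K L ι H (a + ι t)                     ≈⟨ subgroupPoly-translationInvariant H (G⊆H t∈G) a ⟩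
    evalSubgroupPoly K L ι H a                             ∎
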